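{- Let $G=(V,E)$ be a finite simple graph of order $n$ with no isolated vertices, minimum degree $\delta$ and maximum degree $\Delta$, and let $f$ be a minimum signed total dominating function of $G$. Let $V_+=\{v\in V: f(v)=1\}$, $V_-=\{v\in V: f(v)=-1\}$, let $E_+$ and $E_-$ denote the numbers of edges of the induced subgraphs $G[V_+]$ and $G[V_-]$ respectively, let $[V_+,V_-]$ be the set of edges with one end in $V_+$ and the other in $V_-$, and let $V_e$ be the set of vertices of $G$ of even degree. Then (a) $\left(\lfloor\frac{\delta}{2}\rfloor+1\right)|V_-|\leq |[V_+,V_-]|\leq\left(\lceil\frac{\Delta}{2}\rceil-1\right)|V_+|$; (b) $n+|V_-|+4E_-+|V_e|\leq 2E_++|[V_+,V_-]|$.
   Context: A signed total dominating function (STDF) of $G$ is a function $f:V\to\{ -1,1\}$ with $\sum_{u\in N(v)}f(u)\geq 1$ for every $v\in V$, where $N(v)$ is the open neighborhood of $v$. A minimum STDF is one minimizing $\sum_{v\in V}f(v)$; this minimum is the signed total domination number $\gamma_{st}(G)$. -}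

module Defs where

open import Data.Bool using (Bool; true; false; _∧_; if_then_else_; T)
open import Data.Nat using (ℕ; zero; suc; _+_; _≤_; _<ᵇ_; _%_; _≡ᵇ_)
open import Data.Fin using (Fin; toℕ)
open import Data.List using (List; map; foldr; allFin)
open import Data.Integer as ℤ using (ℤ; +_; -_)
open import Data.Product using (_×_; ∃)
open import Relation.Binary.PropositionalEquality using (_≡_)

record Graph (n : ℕ) : Set where
  field
    adj   : Fin n → Fin n → Bool
    sym   : ∀ u v → adj u v ≡ adj v u
    irref : ∀ v → adj v v ≡ false
open Graph public

count : ∀ {n} → (Fin n → Bool) → ℕ
count {n} P = foldr (λ v acc → if P v then suc acc else acc) 0 (allFin n)

sumℤ : ∀ {n} → (Fin n → ℤ) → ℤ
sumℤ {n} g = foldr (λ v acc → g v ℤ.+ acc) (+ 0) (allFin n)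

countPairs : ∀ {n} → (Fin n → Fin n → Bool) → ℕ
countPairs {n} P = foldr (λ u acc → count (P u) + acc) 0 (allFin n)

deg : ∀ {n} → Graph n → Fin n → ℕ
deg G v = count (adj G v)

NoIsolated : ∀ {n} → Graph n → Set
NoIsolated G = ∀ v → 1 ≤ deg G v

IsMinDegree : ∀ {n} → Graph n → ℕ → Set
IsMinDegree G δ = (∀ v → δ ≤ deg G v) × ∃ λ v → deg G v ≡ δ

IsMaxDegree : ∀ {n} → Graph n → ℕ → Set
IsMaxDegree G Δ = (∀ v → deg G v ≤ Δ) × ∃ λ v → deg G v ≡ Δ

data Sign : Set where
  plus minus : Sign

⟦_⟧ : Sign → ℤ
⟦ plus ⟧  = + 1
⟦ minus ⟧ = - (+ 1)

isPlus : Sign → Bool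
isPlus plus  = true
isPlus minus = false

isMinus : Sign → Bool
isMinus plus  = false
isMinus minus = true

nbrSum : ∀ {n} → Graph n → (Fin n → Sign) → Fin n → ℤ
nbrSum G f v = sumℤ (λ u → if adj G v u then ⟦ f u ⟧ else + 0)

weight : ∀ {n} → (Fin n → Sign) → ℤ
weight f = sumℤ (λ v → ⟦ f v ⟧)

IsSTDF : ∀ {n} → Graph n → (Fin n → Sign) → Set
IsSTDF G f = ∀ v → + 1 ℤ.≤ nbrSum G f v

IsMinSTDF : ∀ {n} → Graph n → (Fin n → Sign) → Set
IsMinSTDF G f = IsSTDF G f × (∀ g → IsSTDF G g → weight f ℤ.≤ weight g)

cardVplus : ∀ {n} → (Fin n → Sign) → ℕ
cardVplus f = count (λ v → isPlus (f v))

cardVminus : ∀ {n} → (Fin n → Sign) → ℕ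
cardVminus f = count (λ v → isMinus (f v))

Eplus : ∀ {n} → Graph n → (Fin n → Sign) → ℕ
Eplus G f = countPairs (λ u v → (toℕ u <ᵇ toℕ v) ∧ adj G u v ∧ isPlus (f u) ∧ isPlus (f v))

Eminus : ∀ {n} → Graph n → (Fin n → Sign) → ℕ
Eminus G f = countPairs (λ u v → (toℕ u <ᵇ toℕ v) ∧ adj G u v ∧ isMinus (f u) ∧ isMinus (f v))

cut : ∀ {n} → Graph n → (Fin n → Sign) → ℕ
cut G f = countPairs (λ u v → adj G u v ∧ isPlus (f u) ∧ isMinus (f v))

cardVeven : ∀ {n} → Graph n → ℕ
cardVeven G = count (λ v → (deg G v % 2) ≡ᵇ 0)

-- For a vertex u write d⁺(u) and d⁻(u) for the numbers of neighbours of u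
-- in V₊ and in V₋.  Then deg(u) = d⁺(u) + d⁻(u) and f(N(u)) = d⁺(u) - d⁻(u),
-- so the STDF condition f(N(u)) ≥ 1 says d⁻(u) + 1 ≤ d⁺(u); when deg(u) is
-- even, d⁺(u) - d⁻(u) is even as well, hence d⁻(u) + 2 ≤ d⁺(u).  These
-- local inequalities already give d⁺(u) > ⌊δ/2⌋ and d⁻(u) < ⌈Δ/2⌉.
--
-- The global quantities are sums of the local ones (double counting):
--   |[V₊,V₋]| = Σ_{u∈V₊} d⁻(u) = Σ_{u∈V₋} d⁺(u),
--   2E₊ = Σ_{u∈V₊} d⁺(u),   2E₋ = Σ_{u∈V₋} d⁻(u).
-- Summing the local bounds over V₋ and V₊ yields (a); summing the parity
-- refined bound over V, and the plain bound over V₋, yields (b).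
module Submission where

open import Defs hiding (sym)
open import Data.Nat using (ℕ; suc; _+_; _*_; _∸_; _≤_; _<_; s≤s; z≤n;
  _<ᵇ_; _%_; _≡ᵇ_; ⌊_/2⌋; ⌈_/2⌉)
open import Data.Nat.Properties
open import Data.Nat.DivMod using ([m+kn]%n≡m%n)
open import Data.Nat.Solver using (module +-*-Solver)
open import Data.Bool using (Bool; true; false; _∧_; if_then_else_; T)
open import Data.Bool.Properties using (∧-comm)
open import Data.Fin using (Fin; toℕ)
import Data.Fin.Properties as Fin
open import Data.List using (List; []; _∷_; foldr; allFin; length)
open import Data.List.Properties using (length-tabulate)
open import Data.Integer as ℤ using (ℤ; +_)
import Data.Integer.Properties as ℤ
open import Data.Product using (_×_; _,_)
open import Data.Sum using (inj₁; inj₂)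
open import Data.Empty using (⊥-elim)
open import Relation.Binary.PropositionalEquality
import Algebra.Properties.CommutativeSemigroup as CommSemigroupProps

open CommSemigroupProps +-commutativeSemigroup using (interchange)
open CommSemigroupProps ℤ.+-commutativeSemigroup using ()
  renaming (interchange to ℤ-interchange)

when : Bool → ℕ → ℕ
when b x = if b then x else 0

𝟙 : Bool → ℕ
𝟙 b = when b 1

when-mono : ∀ b {x y} → x ≤ y → when b x ≤ when b y
when-mono true  x≤y = x≤y
when-mono false _   = z≤n

when-+ : ∀ b x y → when b (x + y) ≡ when b x + when b y
when-+ true  x y = refl
when-+ false x y = refl

*-𝟙 : ∀ c b → c * 𝟙 b ≡ when b c
*-𝟙 c true  = *-identityʳ c
*-𝟙 c false = *-zeroʳ c

𝟙-∧-middle : ∀ a b c → 𝟙 (a ∧ b ∧ c) ≡ when b (𝟙 (a ∧ c))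
𝟙-∧-middle a     true  c = refl
𝟙-∧-middle true  false c = refl
𝟙-∧-middle false false c = refl

∧-swapʳ : ∀ a b c → (a ∧ b ∧ c) ≡ (a ∧ c ∧ b)
∧-swapʳ true  b c = ∧-comm b c
∧-swapʳ false b c = refl

⌊/2⌋<-double : ∀ k m → k < m + m → ⌊ k /2⌋ < m
⌊/2⌋<-double k m k<2m = begin
  ⌊ suc (suc k) /2⌋   ≤⟨ ⌊n/2⌋-mono (s≤s k<2m) ⟩
  ⌈ m + m /2⌉         ≡⟨ sym (n≡⌈n+n/2⌉ m) ⟩
  m                   ∎
  where open ≤-Reasoning

double<⇒<⌈/2⌉ : ∀ m k → m + m < k → m < ⌈ k /2⌉
double<⇒<⌈/2⌉ m k 2m<k = begin
  suc m                 ≡⟨ cong suc (n≡⌊n+n/2⌋ m) ⟩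
  ⌈ suc (m + m) /2⌉     ≤⟨ ⌈n/2⌉-mono 2m<k ⟩
  ⌈ k /2⌉               ∎
  where open ≤-Reasoning

-- The form in which ⌈Δ/2⌉ - 1 appears in the statement.
<⇒≤∸1 : ∀ {m k} → m < k → m ≤ k ∸ 1
<⇒≤∸1 (s≤s m≤k) = m≤k

even? : ℕ → Bool
even? d = d % 2 ≡ᵇ 0

odd-not-even : ∀ k → even? (suc (k + k)) ≡ false
odd-not-even k = cong (λ r → r ≡ᵇ 0) (begin
  suc (k + k) % 2     ≡⟨ cong (λ x → suc x % 2) k+k≡k*2 ⟩
  (1 + k * 2) % 2     ≡⟨ [m+kn]%n≡m%n 1 k 2 ⟩
  1                   ∎)
  where
  open ≡-Reasoning
  k+k≡k*2 : k + k ≡ k * 2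
  k+k≡k*2 = trans (cong (_+_ k) (sym (+-identityʳ k))) (*-comm 2 k)

-- The final linear combination in part (b): add the two summed bounds
-- and cancel the cut term.
combine-part-b : ∀ n ve vm em ep c →
  ve + (n + (c + (em + em))) ≤ (ep + ep) + c → vm + (em + em) ≤ c →
  n + vm + 4 * em + ve ≤ 2 * ep + c
combine-part-b n ve vm em ep c vertex-bound minus-bound =
  subst₂ _≤_ (solve 4 (λ n ve vm em → (ve :+ n :+ (em :+ em)) :+ (vm :+ (em :+ em))
                                     := n :+ vm :+ con 4 :* em :+ ve) refl n ve vm em)
             (solve 2 (λ ep c → (ep :+ ep) :+ c := con 2 :* ep :+ c) refl ep c)
             (+-mono-≤ without-cut minus-bound)
  where
  open +-*-Solver
  without-cut : ve + n + (em + em) ≤ ep + ep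
  without-cut = +-cancelʳ-≤ c _ _ (subst (_≤ (ep + ep) + c)
    (solve 4 (λ ve n c em → ve :+ (n :+ (c :+ (em :+ em))) := (ve :+ n :+ (em :+ em)) :+ c)
      refl ve n c em) vertex-bound)

module _ {A : Set} where

  sumL : (A → ℕ) → List A → ℕ
  sumL g = foldr (λ x acc → g x + acc) 0

  count≡sumL : ∀ (P : A → Bool) xs →
    foldr (λ x acc → if P x then suc acc else acc) 0 xs ≡ sumL (λ x → 𝟙 (P x)) xs
  count≡sumL P []       = refl
  count≡sumL P (x ∷ xs) with P x
  ... | true  = cong suc (count≡sumL P xs)
  ... | false = count≡sumL P xs

  sumL-cong : ∀ {g h : A → ℕ} xs → (∀ x → g x ≡ h x) → sumL g xs ≡ sumL h xs
  sumL-cong []       g≗h = refl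
  sumL-cong (x ∷ xs) g≗h = cong₂ _+_ (g≗h x) (sumL-cong xs g≗h)

  sumL-mono : ∀ {g h : A → ℕ} xs → (∀ x → g x ≤ h x) → sumL g xs ≤ sumL h xs
  sumL-mono []       g≤h = z≤n
  sumL-mono (x ∷ xs) g≤h = +-mono-≤ (g≤h x) (sumL-mono xs g≤h)

  sumL-+ : ∀ (g h : A → ℕ) xs → sumL (λ x → g x + h x) xs ≡ sumL g xs + sumL h xs
  sumL-+ g h []       = refl
  sumL-+ g h (x ∷ xs) =
    trans (cong (_+_ (g x + h x)) (sumL-+ g h xs)) (interchange (g x) (h x) _ _)

  sumL-*ˡ : ∀ c (g : A → ℕ) xs → sumL (λ x → c * g x) xs ≡ c * sumL g xs
  sumL-*ˡ c g []       = sym (*-zeroʳ c)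
  sumL-*ˡ c g (x ∷ xs) =
    trans (cong (_+_ (c * g x)) (sumL-*ˡ c g xs)) (sym (*-distribˡ-+ c (g x) _))

  sumL-zero : ∀ xs → sumL (λ _ → 0) xs ≡ 0
  sumL-zero []       = refl
  sumL-zero (x ∷ xs) = sumL-zero xs

  sumL-when : ∀ b (g : A → ℕ) xs → sumL (λ x → when b (g x)) xs ≡ when b (sumL g xs)
  sumL-when true  g xs = refl
  sumL-when false g xs = sumL-zero xs

  sumL-one : ∀ xs → sumL (λ _ → 1) xs ≡ length xs
  sumL-one []       = refl
  sumL-one (x ∷ xs) = cong suc (sumL-one xs)

  sumℤ-difference : ∀ (h : A → ℤ) (a b : A → ℕ) →
    (∀ x → h x ℤ.+ + b x ≡ + a x) → ∀ xs →
    foldr (λ x acc → h x ℤ.+ acc) (+ 0) xs ℤ.+ + sumL b xs ≡ + sumL a xs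
  sumℤ-difference h a b termwise []       = refl
  sumℤ-difference h a b termwise (x ∷ xs) =
    trans (ℤ-interchange (h x) _ (+ b x) (+ sumL b xs))
          (cong₂ ℤ._+_ (termwise x) (sumℤ-difference h a b termwise xs))

sumL-swap : ∀ {A B : Set} (g : A → B → ℕ) xs ys →
  sumL (λ x → sumL (g x) ys) xs ≡ sumL (λ y → sumL (λ x → g x y) xs) ys
sumL-swap g []       ys = sym (sumL-zero ys)
sumL-swap g (x ∷ xs) ys =
  trans (cong (_+_ (sumL (g x) ys)) (sumL-swap g xs ys))
        (sym (sumL-+ (g x) (λ y → sumL (λ x′ → g x′ y) xs) ys))

<ᵇ-true⇒< : ∀ a b → (a <ᵇ b) ≡ true → a < b
<ᵇ-true⇒< a b eq = <ᵇ⇒< a b (subst T (sym eq) _)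

<ᵇ-false⇒≥ : ∀ a b → (a <ᵇ b) ≡ false → b ≤ a
<ᵇ-false⇒≥ a b eq = ≮⇒≥ (λ a<b → subst T eq (<⇒<ᵇ a<b))

module _ {n : ℕ} where

  ∑ : (Fin n → ℕ) → ℕ
  ∑ g = sumL g (allFin n)

  count≡∑ : ∀ (P : Fin n → Bool) → count P ≡ ∑ (λ v → 𝟙 (P v))
  count≡∑ P = count≡sumL P (allFin n)

  ∑-one : ∑ (λ _ → 1) ≡ n
  ∑-one = trans (sumL-one (allFin n)) (length-tabulate (λ v → v))

  ∑-when-const : ∀ (P : Fin n → Bool) c → ∑ (λ v → when (P v) c) ≡ c * count P
  ∑-when-const P c = begin
    ∑ (λ v → when (P v) c)   ≡⟨ sumL-cong (allFin n) (λ v → sym (*-𝟙 c (P v))) ⟩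
    ∑ (λ v → c * 𝟙 (P v))    ≡⟨ sumL-*ˡ c (λ v → 𝟙 (P v)) (allFin n) ⟩
    c * ∑ (λ v → 𝟙 (P v))    ≡⟨ cong (c *_) (sym (count≡∑ P)) ⟩
    c * count P              ∎
    where open ≡-Reasoning

  pairSum : (Fin n → Fin n → Bool) → ℕ
  pairSum R = ∑ (λ u → ∑ (λ v → 𝟙 (R u v)))

  countPairs≡pairSum : ∀ R → countPairs R ≡ pairSum R
  countPairs≡pairSum R = sumL-cong (allFin n) (λ u → count≡∑ (R u))

  pairSum-transpose : ∀ R → pairSum R ≡ pairSum (λ u v → R v u)
  pairSum-transpose R = sumL-swap (λ u v → 𝟙 (R u v)) (allFin n) (allFin n)

  split-by-order : ∀ (R : Fin n → Fin n → Bool) →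
    (∀ u v → R u v ≡ R v u) → (∀ u → R u u ≡ false) → ∀ u v →
    𝟙 (R u v) ≡ 𝟙 ((toℕ u <ᵇ toℕ v) ∧ R u v) + 𝟙 ((toℕ v <ᵇ toℕ u) ∧ R v u)
  split-by-order R R-sym R-irrefl u v
    with toℕ u <ᵇ toℕ v in u<v | toℕ v <ᵇ toℕ u in v<u
  ... | true  | true  = ⊥-elim (<-asym (<ᵇ-true⇒< (toℕ u) (toℕ v) u<v)
                                         (<ᵇ-true⇒< (toℕ v) (toℕ u) v<u))
  ... | true  | false = sym (+-identityʳ _)
  ... | false | true  = cong 𝟙 (R-sym u v)
  ... | false | false = cong 𝟙 (subst (λ w → R u w ≡ false) u≡v (R-irrefl u))
    where
    u≡v : u ≡ v
    u≡v = Fin.toℕ-injective (≤-antisym (<ᵇ-false⇒≥ (toℕ v) (toℕ u) v<u)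
                                     (<ᵇ-false⇒≥ (toℕ u) (toℕ v) u<v))

  halving : ∀ (R : Fin n → Fin n → Bool) →
    (∀ u v → R u v ≡ R v u) → (∀ u → R u u ≡ false) →
    countPairs (λ u v → (toℕ u <ᵇ toℕ v) ∧ R u v)
      + countPairs (λ u v → (toℕ u <ᵇ toℕ v) ∧ R u v) ≡ pairSum R
  halving R R-sym R-irrefl = begin
    countPairs R< + countPairs R<
      ≡⟨ cong₂ _+_ (countPairs≡pairSum R<) (countPairs≡pairSum R<) ⟩
    pairSum R< + pairSum R<
      ≡⟨ cong (_+_ (pairSum R<)) (pairSum-transpose R<) ⟩
    pairSum R< + pairSum (λ u v → R< v u)
      ≡⟨ sym (sumL-+ (λ u → ∑ (λ v → 𝟙 (R< u v))) (λ u → ∑ (λ v → 𝟙 (R< v u))) (allFin n)) ⟩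
    ∑ (λ u → ∑ (λ v → 𝟙 (R< u v)) + ∑ (λ v → 𝟙 (R< v u)))
      ≡⟨ sumL-cong (allFin n) (λ u → sym (sumL-+ (λ v → 𝟙 (R< u v)) (λ v → 𝟙 (R< v u)) (allFin n))) ⟩
    ∑ (λ u → ∑ (λ v → 𝟙 (R< u v) + 𝟙 (R< v u)))
      ≡⟨ sumL-cong (allFin n) (λ u → sumL-cong (allFin n) (λ v →
           sym (split-by-order R R-sym R-irrefl u v))) ⟩
    pairSum R ∎
    where
    open ≡-Reasoning
    R< : Fin n → Fin n → Bool
    R< u v = (toℕ u <ᵇ toℕ v) ∧ R u v

-- Double counting for a graph G with a sign assignment f

module Counting {n : ℕ} (G : Graph n) (f : Fin n → Sign) where

  nbrs : (Sign → Bool) → Fin n → ℕ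
  nbrs Q u = ∑ (λ v → 𝟙 (adj G u v ∧ Q (f v)))

  d⁺ d⁻ : Fin n → ℕ
  d⁺ = nbrs isPlus
  d⁻ = nbrs isMinus

  ∑[_]_ : (Sign → Bool) → (Fin n → ℕ) → ℕ
  ∑[ Q ] h = ∑ (λ u → when (Q (f u)) (h u))

  ∑[]-mono : ∀ Q {g h : Fin n → ℕ} → (∀ u → g u ≤ h u) → ∑[ Q ] g ≤ ∑[ Q ] h
  ∑[]-mono Q g≤h = sumL-mono (allFin n) (λ u → when-mono (Q (f u)) (g≤h u))

  ∑[]-const : ∀ Q c → ∑[ Q ] (λ _ → c) ≡ c * count (λ u → Q (f u))
  ∑[]-const Q c = ∑-when-const (λ u → Q (f u)) c

  ∑[]-suc : ∀ Q h → ∑[ Q ] (λ u → suc (h u)) ≡ count (λ u → Q (f u)) + ∑[ Q ] h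
  ∑[]-suc Q h = begin
    ∑[ Q ] (λ u → suc (h u))
      ≡⟨ sumL-cong (allFin n) (λ u → when-+ (Q (f u)) 1 (h u)) ⟩
    ∑ (λ u → 𝟙 (Q (f u)) + when (Q (f u)) (h u))
      ≡⟨ sumL-+ (λ u → 𝟙 (Q (f u))) (λ u → when (Q (f u)) (h u)) (allFin n) ⟩
    ∑ (λ u → 𝟙 (Q (f u))) + ∑[ Q ] h
      ≡⟨ cong (_+ ∑[ Q ] h) (sym (count≡∑ (λ u → Q (f u)))) ⟩
    count (λ u → Q (f u)) + ∑[ Q ] h ∎
    where open ≡-Reasoning

  ∑-split : ∀ h → ∑ h ≡ ∑[ isPlus ] h + ∑[ isMinus ] h
  ∑-split h = trans (sumL-cong (allFin n) by-sign)
    (sumL-+ (λ u → when (isPlus (f u)) (h u)) (λ u → when (isMinus (f u)) (h u)) (allFin n))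
    where
    by-sign : ∀ u → h u ≡ when (isPlus (f u)) (h u) + when (isMinus (f u)) (h u)
    by-sign u with f u
    ... | plus  = sym (+-identityʳ (h u))
    ... | minus = refl

  deg≡d⁺+d⁻ : ∀ u → deg G u ≡ d⁺ u + d⁻ u
  deg≡d⁺+d⁻ u = trans (count≡∑ (adj G u))
    (trans (sumL-cong (allFin n) by-sign) (sumL-+ _ _ (allFin n)))
    where
    by-sign : ∀ v → 𝟙 (adj G u v) ≡ 𝟙 (adj G u v ∧ isPlus (f v)) + 𝟙 (adj G u v ∧ isMinus (f v))
    by-sign v with adj G u v | f v
    ... | true  | plus  = refl
    ... | true  | minus = refl
    ... | false | _     = refl

  nbrSum+d⁻≡d⁺ : ∀ u → nbrSum G f u ℤ.+ + d⁻ u ≡ + d⁺ u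
  nbrSum+d⁻≡d⁺ u = sumℤ-difference (λ v → if adj G u v then ⟦ f v ⟧ else + 0)
    (λ v → 𝟙 (adj G u v ∧ isPlus (f v))) (λ v → 𝟙 (adj G u v ∧ isMinus (f v))) by-sign (allFin n)
    where
    by-sign : ∀ v → (if adj G u v then ⟦ f v ⟧ else + 0) ℤ.+ + 𝟙 (adj G u v ∧ isMinus (f v))
                    ≡ + 𝟙 (adj G u v ∧ isPlus (f v))
    by-sign v with adj G u v | f v
    ... | true  | plus  = refl
    ... | true  | minus = refl
    ... | false | _     = refl

  signedPairs : (Sign → Bool) → (Sign → Bool) → Fin n → Fin n → Bool
  signedPairs P Q u v = adj G u v ∧ P (f u) ∧ Q (f v)

  signedPairs-transpose : ∀ P Q u v → signedPairs P Q v u ≡ signedPairs Q P u v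
  signedPairs-transpose P Q u v =
    trans (cong (λ a → a ∧ P (f v) ∧ Q (f u)) (Graph.sym G v u)) (∧-swapʳ (adj G u v) (P (f v)) (Q (f u)))

  pairSum-signed : ∀ P Q → pairSum (signedPairs P Q) ≡ ∑[ P ] (nbrs Q)
  pairSum-signed P Q = sumL-cong (allFin n) λ u →
    trans (sumL-cong (allFin n) (λ v → 𝟙-∧-middle (adj G u v) (P (f u)) (Q (f v))))
          (sumL-when (P (f u)) (λ v → 𝟙 (adj G u v ∧ Q (f v))) (allFin n))

  cut≡∑₊d⁻ : cut G f ≡ ∑[ isPlus ] d⁻
  cut≡∑₊d⁻ = trans (countPairs≡pairSum (signedPairs isPlus isMinus)) (pairSum-signed isPlus isMinus)

  cut≡∑₋d⁺ : cut G f ≡ ∑[ isMinus ] d⁺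
  cut≡∑₋d⁺ = begin
    cut G f
      ≡⟨ countPairs≡pairSum (signedPairs isPlus isMinus) ⟩
    pairSum (signedPairs isPlus isMinus)
      ≡⟨ pairSum-transpose (signedPairs isPlus isMinus) ⟩
    pairSum (λ u v → signedPairs isPlus isMinus v u)
      ≡⟨ sumL-cong (allFin n) (λ u → sumL-cong (allFin n) (λ v →
           cong 𝟙 (signedPairs-transpose isPlus isMinus u v))) ⟩
    pairSum (signedPairs isMinus isPlus)
      ≡⟨ pairSum-signed isMinus isPlus ⟩
    ∑[ isMinus ] d⁺ ∎
    where open ≡-Reasoning

  twice-edges : ∀ Q →
    countPairs (λ u v → (toℕ u <ᵇ toℕ v) ∧ signedPairs Q Q u v)
      + countPairs (λ u v → (toℕ u <ᵇ toℕ v) ∧ signedPairs Q Q u v) ≡ ∑[ Q ] (nbrs Q)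
  twice-edges Q = trans
    (halving (signedPairs Q Q) (λ u v → signedPairs-transpose Q Q v u)
             (λ u → cong (λ a → a ∧ Q (f u) ∧ Q (f u)) (irref G u)))
    (pairSum-signed Q Q)

  ∑d⁻≡cut+2E₋ : ∑ d⁻ ≡ cut G f + (Eminus G f + Eminus G f)
  ∑d⁻≡cut+2E₋ = trans (∑-split d⁻) (sym (cong₂ _+_ cut≡∑₊d⁻ (twice-edges isMinus)))

  ∑d⁺≡2E₊+cut : ∑ d⁺ ≡ (Eplus G f + Eplus G f) + cut G f
  ∑d⁺≡2E₊+cut = trans (∑-split d⁺) (sym (cong₂ _+_ (twice-edges isPlus) cut≡∑₋d⁺))

  ∑-parity-majority : ∑ (λ u → 𝟙 (even? (deg G u)) + suc (d⁻ u)) ≡ cardVeven G + (n + ∑ d⁻)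
  ∑-parity-majority = begin
    ∑ (λ u → 𝟙 (even? (deg G u)) + suc (d⁻ u))
      ≡⟨ sumL-+ (λ u → 𝟙 (even? (deg G u))) (λ u → suc (d⁻ u)) (allFin n) ⟩
    ∑ (λ u → 𝟙 (even? (deg G u))) + ∑ (λ u → suc (d⁻ u))
      ≡⟨ cong₂ _+_ (sym (count≡∑ (λ u → even? (deg G u)))) (sumL-+ (λ _ → 1) d⁻ (allFin n)) ⟩
    cardVeven G + (∑ (λ (_ : Fin n) → 1) + ∑ d⁻)
      ≡⟨ cong (λ m → cardVeven G + (m + ∑ d⁻)) ∑-one ⟩
    cardVeven G + (n + ∑ d⁻) ∎
    where open ≡-Reasoning

  module Bounds (stdf : IsSTDF G f) where

    plus-majority : ∀ u → suc (d⁻ u) ≤ d⁺ u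
    plus-majority u = ℤ.drop‿+≤+ (begin
      + 1 ℤ.+ + d⁻ u          ≤⟨ ℤ.+-monoˡ-≤ (+ d⁻ u) (stdf u) ⟩
      nbrSum G f u ℤ.+ + d⁻ u ≡⟨ nbrSum+d⁻≡d⁺ u ⟩
      + d⁺ u                  ∎)
      where open ℤ.≤-Reasoning

    -- At an even-degree vertex the majority is at least 2, since
    -- d⁺(u) = d⁻(u) + 1 would make deg(u) = 2 d⁻(u) + 1 odd.
    parity-majority : ∀ u → 𝟙 (even? (deg G u)) + suc (d⁻ u) ≤ d⁺ u
    parity-majority u with m≤n⇒m<n∨m≡n (plus-majority u)
    ... | inj₁ strict = ≤-trans (+-monoˡ-≤ (suc (d⁻ u)) (𝟙≤1 (even? (deg G u)))) strict
      where
      𝟙≤1 : ∀ b → 𝟙 b ≤ 1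
      𝟙≤1 true  = ≤-refl
      𝟙≤1 false = z≤n
    ... | inj₂ tight = subst (λ b → 𝟙 b + suc (d⁻ u) ≤ d⁺ u) (sym odd-degree) (plus-majority u)
      where
      odd-degree : even? (deg G u) ≡ false
      odd-degree = trans (cong even? (trans (deg≡d⁺+d⁻ u) (cong (_+ d⁻ u) (sym tight))))
                         (odd-not-even (d⁻ u))

    d⁺>⌊δ/2⌋ : ∀ {δ} → (∀ v → δ ≤ deg G v) → ∀ u → ⌊ δ /2⌋ < d⁺ u
    d⁺>⌊δ/2⌋ {δ} δ-min u = ⌊/2⌋<-double δ (d⁺ u) (begin-strict
      δ                ≤⟨ δ-min u ⟩
      deg G u          ≡⟨ deg≡d⁺+d⁻ u ⟩
      d⁺ u + d⁻ u      <⟨ +-monoʳ-< (d⁺ u) (plus-majority u) ⟩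
      d⁺ u + d⁺ u      ∎)
      where open ≤-Reasoning

    d⁻<⌈Δ/2⌉ : ∀ {Δ} → (∀ v → deg G v ≤ Δ) → ∀ u → d⁻ u < ⌈ Δ /2⌉
    d⁻<⌈Δ/2⌉ {Δ} Δ-max u = double<⇒<⌈/2⌉ (d⁻ u) Δ (begin-strict
      d⁻ u + d⁻ u      <⟨ +-monoˡ-< (d⁻ u) (plus-majority u) ⟩
      d⁺ u + d⁻ u      ≡⟨ deg≡d⁺+d⁻ u ⟨
      deg G u          ≤⟨ Δ-max u ⟩
      Δ                ∎)
      where open ≤-Reasoning

    -- Part (a), lower bound: sum d⁺ > ⌊δ/2⌋ over V₋.
    cut-lower : ∀ {δ} → (∀ v → δ ≤ deg G v) → (⌊ δ /2⌋ + 1) * cardVminus f ≤ cut G f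
    cut-lower {δ} δ-min = begin
      (⌊ δ /2⌋ + 1) * cardVminus f     ≡⟨ ∑[]-const isMinus (⌊ δ /2⌋ + 1) ⟨
      ∑[ isMinus ] (λ _ → ⌊ δ /2⌋ + 1) ≤⟨ ∑[]-mono isMinus (λ u →
                                            subst (_≤ d⁺ u) (+-comm 1 ⌊ δ /2⌋) (d⁺>⌊δ/2⌋ δ-min u)) ⟩
      ∑[ isMinus ] d⁺                  ≡⟨ cut≡∑₋d⁺ ⟨
      cut G f                          ∎
      where open ≤-Reasoning

    -- Part (a), upper bound: sum d⁻ < ⌈Δ/2⌉ over V₊.
    cut-upper : ∀ {Δ} → (∀ v → deg G v ≤ Δ) → cut G f ≤ (⌈ Δ /2⌉ ∸ 1) * cardVplus f
    cut-upper {Δ} Δ-max = begin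
      cut G f                          ≡⟨ cut≡∑₊d⁻ ⟩
      ∑[ isPlus ] d⁻                   ≤⟨ ∑[]-mono isPlus (λ u → <⇒≤∸1 (d⁻<⌈Δ/2⌉ Δ-max u)) ⟩
      ∑[ isPlus ] (λ _ → ⌈ Δ /2⌉ ∸ 1)  ≡⟨ ∑[]-const isPlus (⌈ Δ /2⌉ ∸ 1) ⟩
      (⌈ Δ /2⌉ ∸ 1) * cardVplus f      ∎
      where open ≤-Reasoning

    -- Part (b), first ingredient: parity-majority summed over all vertices.
    vertex-sum-bound :
      cardVeven G + (n + (cut G f + (Eminus G f + Eminus G f)))
        ≤ (Eplus G f + Eplus G f) + cut G f
    vertex-sum-bound = begin
      cardVeven G + (n + (cut G f + (Eminus G f + Eminus G f)))
        ≡⟨ cong (λ x → cardVeven G + (n + x)) ∑d⁻≡cut+2E₋ ⟨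
      cardVeven G + (n + ∑ d⁻)                       ≡⟨ ∑-parity-majority ⟨
      ∑ (λ u → 𝟙 (even? (deg G u)) + suc (d⁻ u))     ≤⟨ sumL-mono (allFin n) parity-majority ⟩
      ∑ d⁺                                           ≡⟨ ∑d⁺≡2E₊+cut ⟩
      (Eplus G f + Eplus G f) + cut G f              ∎
      where open ≤-Reasoning

    -- Part (b), second ingredient: plus-majority summed over V₋.
    minus-sum-bound : cardVminus f + (Eminus G f + Eminus G f) ≤ cut G f
    minus-sum-bound = begin
      cardVminus f + (Eminus G f + Eminus G f) ≡⟨ cong (_+_ (cardVminus f)) (twice-edges isMinus) ⟩
      cardVminus f + ∑[ isMinus ] d⁻           ≡⟨ ∑[]-suc isMinus d⁻ ⟨
      ∑[ isMinus ] (λ u → suc (d⁻ u))          ≤⟨ ∑[]-mono isMinus plus-majority ⟩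
      ∑[ isMinus ] d⁺                          ≡⟨ cut≡∑₋d⁺ ⟨
      cut G f                                  ∎
      where open ≤-Reasoning

lemma3p1 : (n : ℕ) (G : Graph n) → NoIsolated G →
    (δ Δ : ℕ) → IsMinDegree G δ → IsMaxDegree G Δ →
    (f : Fin n → Sign) → IsMinSTDF G f →
    ((⌊ δ /2⌋ + 1) * cardVminus f ≤ cut G f
      × cut G f ≤ (⌈ Δ /2⌉ ∸ 1) * cardVplus f)
    × (n + cardVminus f + 4 * Eminus G f + cardVeven G ≤ 2 * Eplus G f + cut G f)
lemma3p1 n G _ δ Δ (δ-min , _) (Δ-max , _) f (stdf , _) =
  (cut-lower δ-min , cut-upper Δ-max) ,
  combine-part-b n (cardVeven G) (cardVminus f) (Eminus G f) (Eplus G f) (cut G f)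
                 vertex-sum-bound minus-sum-bound
  where open Counting.Bounds G f stdf
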